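{- Let $b>1$ and $m\ge 0$ be integers, and consider integer variables $x_{i,j}\in[0,d_{i,j}]$ and integers $0\le A_{i,j}<b$ for $1\le i\le n$, $0\le j\le m$, together with the sorting-network formula $G$ described in the context (defining outputs $y_0,\dots,y_m$). Let $v_{i,j}\in[0,d_{i,j}]$ and let $A$ be the partial assignment setting $x_{i,j}^k$ true for all $i,j$ and $1\le k\le v_{i,j}$. Then $$\sum_{j=0}^m b^j\big(A_{1,j}v_{1,j}+A_{2,j}v_{2,j}+\cdots+A_{n,j}v_{n,j}\big)>b^{m+1}-1$$ if and only if unit propagation on $G\cup A$ sets $y_m^b$ to true.
   Context: Order encoding: for each $x_{i,j}$, Boolean variables $x_{i,j}^k$ ($1\le k\le d_{i,j}$) meaning $x_{i,j}\ge k$, with clauses $x_{i,j}^{k+1}\rightarrow x_{i,j}^k$. Sorting network encoding $\mathrm{sn}$: for a list of literals $u_1,\dots,u_N$ (repetitions allowed), $\mathrm{sn}(u_1,\dots,u_N)$ introduces output variables $w_1,\dots,w_N$ and a CNF formula (possibly with auxiliary variables) such that in every satisfying assignment $w_k$ is true iff at least $k$ of $u_1,\dots,u_N$ are true, and unit propagation on it is domain consistent for the relation $R_N=\{(u,w)\in\{0,1\}^{2N}: w_k=1\iff |\{l:u_l=1\}|\ge k\}$ (after unit propagation without conflict, every value of every input/output position not yet excluded is supported by a tuple of $R_N$ agreeing with the current assignment; if no tuple agrees, a conflict is derived). Let $X_{i,j}$ be the list consisting of $x_{i,j}^1$ repeated $A_{i,j}$ times, then $x_{i,j}^2$ repeated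 $A_{i,j}$ times, ..., then $x_{i,j}^{d_{i,j}}$ repeated $A_{i,j}$ times. Define $(y_0^1,y_0^2,\dots,y_0^{N_0})=\mathrm{sn}(X_{1,0},\dots,X_{n,0})$ and, for $1\le j\le m$, $(y_j^1,\dots,y_j^{N_j})=\mathrm{sn}(y_{j-1}^b,y_{j-1}^{2b},\dots,y_{j-1}^{b\lfloor N_{j-1}/b\rfloor},X_{1,j},\dots,X_{n,j})$. $G$ is the union of the order-encoding clauses and the clauses of these networks. If $N_m<b$, the variable $y_m^b$ does not exist and is regarded as never being set true. -}

module Defs where

open import Data.Nat using (ℕ; zero; suc; _+_; _*_; _∸_; _^_; _≤_; _<_)
open import Data.Nat.DivMod using (_/_)
open import Data.Bool using (Bool; true; false; not)
open import Data.Fin using (Fin; toℕ)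
import Data.Fin as F
open import Data.List using (List; []; _∷_; _++_; map; concatMap; replicate; upTo; length; lookup)
open import Data.Nat.ListAction using (sum)
open import Data.List.Membership.Propositional using (_∈_)
open import Data.List.Relation.Unary.All using (All)
open import Data.List.Relation.Unary.Any using (Any)
open import Data.Product using (_×_; _,_; proj₁; ∃; Σ)
open import Data.Sum using (_⊎_)
open import Relation.Binary.PropositionalEquality using (_≡_)
open import Relation.Nullary using (¬_)

-- a literal is a variable together with its polarity (true = positive)
Lit : Set → Set
Lit V = V × Bool

neg : {V : Set} → Lit V → Lit V
neg (x , s) = (x , not s)

Clause : Set → Set
Clause V = List (Lit V)

CNF : Set → Set
CNF V = List (Clause V)

LitTrue : {V : Set} → (V → Bool) → Lit V → Set
LitTrue σ (x , s) = σ x ≡ s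

Sat : {V : Set} → (V → Bool) → CNF V → Set
Sat σ F = All (λ C → Any (LitTrue σ) C) F

-- Unit propagation on F ∪ A (A a partial assignment given as a list of
-- literals): UP F A l means that unit propagation sets literal l true.
data UP {V : Set} (F : CNF V) (A : List (Lit V)) : Lit V → Set where
  given : ∀ {l} → l ∈ A → UP F A l
  unit  : ∀ {C l} → C ∈ F → l ∈ C →
          All (λ l′ → l′ ≡ l ⊎ UP F A (neg l′)) C → UP F A l

Conflict : {V : Set} → CNF V → List (Lit V) → Set
Conflict {V} F A =
  (∃ λ (x : V) → UP F A (x , true) × UP F A (x , false))
  ⊎ (∃ λ (C : Clause V) → C ∈ F × All (λ l → UP F A (neg l)) C)

-- variables of a sorting network template on N inputs:
-- inputs u_1..u_N, outputs w_1..w_N (0-indexed by Fin N), auxiliaries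
data TVar (N : ℕ) : Set where
  inp : Fin N → TVar N
  out : Fin N → TVar N
  aux : ℕ → TVar N

data IsPos {N : ℕ} : TVar N → Set where
  inpP : ∀ {l} → IsPos (inp l)
  outP : ∀ {k} → IsPos (out k)

countTrue : (N : ℕ) → (Fin N → Bool) → ℕ
countTrue zero    u = 0
countTrue (suc N) u with u F.zero
... | true  = suc (countTrue N (λ l → u (F.suc l)))
... | false = countTrue N (λ l → u (F.suc l))

-- σ restricted to the positions is a tuple of R_N:
-- w_k = 1 iff at least k of the u_l are 1  (k is 1-indexed: out k ↦ w_{k+1})
InR : (N : ℕ) → (TVar N → Bool) → Set
InR N σ = ∀ (k : Fin N) →
  (σ (out k) ≡ true → suc (toℕ k) ≤ countTrue N (λ l → σ (inp l)))
  × (suc (toℕ k) ≤ countTrue N (λ l → σ (inp l)) → σ (out k) ≡ true)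

Agrees : {N : ℕ} → CNF (TVar N) → List (Lit (TVar N)) → (TVar N → Bool) → Set
Agrees {N} T A σ = ∀ (p : TVar N) → IsPos p → ∀ c → UP T A (p , c) → σ p ≡ c

DomainConsistent : (N : ℕ) → CNF (TVar N) → Set
DomainConsistent N T =
  ∀ (A : List (Lit (TVar N))) → All (λ l → IsPos (proj₁ l)) A →
    (¬ Conflict T A →
       ∀ (p : TVar N) → IsPos p → ∀ (c : Bool) → ¬ UP T A (p , not c) →
         ∃ λ (σ : TVar N → Bool) → InR N σ × Agrees T A σ × σ p ≡ c)
    × ((∀ (σ : TVar N → Bool) → InR N σ → ¬ Agrees T A σ) → Conflict T A)

record SNEncoding : Set where
  field
    net      : (N : ℕ) → CNF (TVar N)
    sound    : ∀ N (σ : TVar N → Bool) → Sat σ (net N) → InR N σ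
    complete : ∀ N (u : Fin N → Bool) →
               ∃ λ (σ : TVar N → Bool) → Sat σ (net N) × (∀ l → σ (inp l) ≡ u l)
    dc       : ∀ N → DomainConsistent N (net N)

-- global variables: x_{i,j}^k, y_j^k (outputs of network j), and
-- auxiliary variable number a of network j
data Var : Set where
  xv : (i j k : ℕ) → Var
  yv : (j k : ℕ) → Var
  av : (j a : ℕ) → Var

range1 : ℕ → List ℕ
range1 n = map suc (upTo n)

range0 : ℕ → List ℕ
range0 m = upTo (suc m)

Xlist : (d A : ℕ → ℕ → ℕ) → ℕ → ℕ → List Var
Xlist d A i j = concatMap (λ k → replicate (A i j) (xv i j k)) (range1 (d i j))

Xcol : (n : ℕ) → (d A : ℕ → ℕ → ℕ) → ℕ → List Var
Xcol n d A j = concatMap (λ i → Xlist d A i j) (range1 n)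

-- ⌊N / b⌋ (only used for b > 1)
divb : ℕ → ℕ → ℕ
divb zero    N = 0
divb (suc b) N = N / suc b

carries : (b j N : ℕ) → List Var
carries b j N = map (λ t → yv j (b * t)) (range1 (divb b N))

inputs : (b n : ℕ) → (d A : ℕ → ℕ → ℕ) → ℕ → List Var
inputs b n d A zero    = Xcol n d A zero
inputs b n d A (suc j) = carries b j (length (inputs b n d A j)) ++ Xcol n d A (suc j)

instVar : (j : ℕ) (u : List Var) → TVar (length u) → Var
instVar j u (inp l) = lookup u l
instVar j u (out k) = yv j (suc (toℕ k))
instVar j u (aux a) = av j a

instCNF : {N : ℕ} → (TVar N → Var) → CNF (TVar N) → CNF Var
instCNF f = map (map (λ l → f (proj₁ l) , Data.Product.proj₂ l))

network : SNEncoding → (b n : ℕ) → (d A : ℕ → ℕ → ℕ) → ℕ → CNF Var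
network E b n d A j =
  instCNF (instVar j u) (SNEncoding.net E (length u))
  where u = inputs b n d A j

orderClauses : (m n : ℕ) → (d : ℕ → ℕ → ℕ) → CNF Var
orderClauses m n d =
  concatMap (λ i → concatMap (λ j →
    map (λ k → (xv i j (suc k) , false) ∷ (xv i j k , true) ∷ [])
        (range1 (d i j ∸ 1)))
    (range0 m)) (range1 n)

G : SNEncoding → (b m n : ℕ) → (d A : ℕ → ℕ → ℕ) → CNF Var
G E b m n d A = orderClauses m n d ++ concatMap (network E b n d A) (range0 m)

assignment : (m n : ℕ) → (v : ℕ → ℕ → ℕ) → List (Lit Var)
assignment m n v =
  concatMap (λ i → concatMap (λ j → map (λ k → (xv i j k , true)) (range1 (v i j)))
    (range0 m)) (range1 n)

weightedSum : (b m n : ℕ) → (A v : ℕ → ℕ → ℕ) → ℕ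
weightedSum b m n A v =
  sum (map (λ j → b ^ j * sum (map (λ i → A i j * v i j) (range1 n))) (range0 m))

-- Let S_j = A_{1,j} v_{1,j} + ⋯ + A_{n,j} v_{n,j}, W_j = Σ_{k ≤ j} b^k S_k and
-- level_j = ⌊W_j / b^j⌋, so that level_0 = S_0 and level_{j+1} = ⌊level_j / b⌋ + S_{j+1}.
-- Give x_{i,j}^k the value k ≤ v_{i,j} and y_j^s the value s ≤ level_j.  Then network j has
-- ⌊level_{j-1} / b⌋ true carries and S_j true x-inputs, i.e. level_j true inputs, so
-- completing every network to a model of its template gives a model of G ∪ A.  Unit
-- propagation is sound for it, hence sets y_m^b only if b ≤ level_m, i.e. b^{m+1} ≤ W_m.
-- Conversely, by induction on j, unit propagation derives every true input of network j,
-- and domain consistency of the network then forces it to derive each y_j^s with s ≤ level_j.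

module Submission where

open import Defs
open import Function using (_∘_; id)
open import Function.Bundles using (_⇔_; mk⇔; Equivalence)
import Function.Properties.Equivalence as ⇔
open import Data.Nat using (ℕ; zero; suc; _+_; _*_; _∸_; _^_; _≤_; _<_; z≤n; s≤s; _⊓_; NonZero)
open import Data.Nat.Properties
open import Data.Nat.DivMod using (_/_; m/n*n≤m; /-monoˡ-≤; /-congˡ; /-congʳ; m*n/n≡m; m/n/o≡m/[n*o]; +-distrib-/-∣ʳ; n/1≡n)
open import Data.Nat.Divisibility using (m∣m*n)
open import Data.Nat.ListAction using (sum)
open import Data.Nat.ListAction.Properties using (sum-++)
open import Data.Bool using (Bool; true; false; if_then_else_)
import Data.Bool.Properties as Bool
open import Data.Fin using (Fin; toℕ; fromℕ<)
import Data.Fin as Fin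
import Data.Fin.Properties as Fin
open import Data.List using (List; []; _∷_; _++_; [_]; map; concat; concatMap; replicate; length; lookup; upTo; filter; allFin)
open import Data.List.Properties using (map-++; map-cong-local; upTo-∷ʳ; length-removeAt′)
open import Data.List.Membership.Propositional using (_∈_; lose; find)
open import Data.List.Membership.Propositional.Properties
  using (∈-map⁺; ∈-map⁻; ∈-concat⁺′; ∈-concatMap⁺; ∈-++⁺ʳ; ∈-upTo⁺; ∈-upTo⁻; ∈-lookup; ∈-filter⁺; ∈-allFin)
import Data.List.Membership.DecPropositional as DecMembership
open import Data.List.Relation.Unary.Any as Any using (Any; here; there; any?; _─_)
import Data.List.Relation.Unary.Any.Properties as Any
open import Data.List.Relation.Unary.All as All using (All; []; _∷_; all?)
open import Data.List.Relation.Unary.All.Properties using (map⁺; concat⁺; ++⁺; replicate⁺; all-filter)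
open import Data.Product using (_×_; _,_; proj₁; proj₂; Σ-syntax)
open import Data.Product.Properties using (≡-dec)
open import Data.Sum using (_⊎_; inj₁; inj₂; map₂)
open import Data.Empty using (⊥-elim)
open import Relation.Nullary using (¬_; Dec; yes; no; does; contradiction)
open import Relation.Nullary.Decidable using (_⊎-dec_; _×-dec_; map′; dec-true; dec-false; does-⇔)
open import Relation.Unary using (Decidable)
open import Relation.Binary.Definitions using (DecidableEquality)
open import Relation.Binary.PropositionalEquality
  using (_≡_; refl; sym; trans; cong; cong₂; subst; subst₂; module ≡-Reasoning)

private variable
  X Y V W : Set

m≤n/o⇔m*o≤n : ∀ m n o .{{_ : NonZero o}} → m ≤ n / o ⇔ m * o ≤ n
m≤n/o⇔m*o≤n m n o = mk⇔
  (λ m≤n/o → ≤-trans (*-monoˡ-≤ o m≤n/o) (m/n*n≤m n o))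
  (λ m*o≤n → subst (_≤ n / o) (m*n/n≡m m o) (/-monoˡ-≤ o m*o≤n))

[m+n*o]/n≡m/n+o : ∀ m n o .{{_ : NonZero n}} → (m + n * o) / n ≡ m / n + o
[m+n*o]/n≡m/n+o m n o = begin
  (m + n * o) / n    ≡⟨ +-distrib-/-∣ʳ m (m∣m*n o) ⟩
  m / n + n * o / n  ≡⟨ cong (λ x → m / n + x / n) (*-comm n o) ⟩
  m / n + o * n / n  ≡⟨ cong (m / n +_) (m*n/n≡m o n) ⟩
  m / n + o          ∎
  where open ≡-Reasoning

m/n^[1+k]≡m/n^k/n : ∀ m n k .{{_ : NonZero n}} →
                    _/_ m (n ^ suc k) {{m^n≢0 n (suc k)}} ≡ _/_ (_/_ m (n ^ k) {{m^n≢0 n k}}) n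
m/n^[1+k]≡m/n^k/n m n k = trans (/-congʳ (*-comm n (n ^ k))) (sym (m/n/o≡m/[n*o] m (n ^ k) n))
  where
  instance
    _ = m^n≢0 n k
    _ = m^n≢0 n (suc k)
    _ = m*n≢0 (n ^ k) n

m∸1<n⇔m≤n : ∀ m n .{{_ : NonZero m}} → m ∸ 1 < n ⇔ m ≤ n
m∸1<n⇔m≤n (suc m) n = mk⇔ id id

dec-true⁻¹ : ∀ {P : Set} (p? : Dec P) → does p? ≡ true → P
dec-true⁻¹ (yes p) _ = p

≡-does : ∀ {P : Set} {x : Bool} (p? : Dec P) → (x ≡ true → P) → (P → x ≡ true) → x ≡ does p?
≡-does {x = true}  p? to from = sym (dec-true p? (to refl))
≡-does {x = false} p? to from = sym (dec-false p? (λ p → contradiction (from p) λ ()))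

∈-─ : ∀ {x y : X} (xs : List X) (x∈xs : x ∈ xs) → y ∈ xs → y ≡ x ⊎ y ∈ (xs ─ x∈xs)
∈-─ (_ ∷ _)  (here refl)  (here refl)  = inj₁ refl
∈-─ (_ ∷ _)  (here refl)  (there y∈xs) = inj₂ y∈xs
∈-─ (_ ∷ _)  (there _)    (here refl)  = inj₂ (here refl)
∈-─ (_ ∷ xs) (there x∈xs) (there y∈xs) with ∈-─ xs x∈xs y∈xs
... | inj₁ y≡x    = inj₁ y≡x
... | inj₂ y∈rest = inj₂ (there y∈rest)

All-concatMap : ∀ {P : Y → Set} {f : X → List Y} {xs} → All (λ x → All P (f x)) xs → All P (concatMap f xs)
All-concatMap = concat⁺ ∘ map⁺

sum-map-upTo-suc : ∀ (g : ℕ → ℕ) j → sum (map g (upTo (suc j))) ≡ sum (map g (upTo j)) + g j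
sum-map-upTo-suc g j = begin
  sum (map g (upTo (suc j)))        ≡⟨ cong (sum ∘ map g) (upTo-∷ʳ j) ⟨
  sum (map g (upTo j ++ [ j ]))     ≡⟨ cong sum (map-++ g (upTo j) [ j ]) ⟩
  sum (map g (upTo j) ++ [ g j ])   ≡⟨ sum-++ (map g (upTo j)) [ g j ] ⟩
  sum (map g (upTo j)) + (g j + 0)  ≡⟨ cong (sum (map g (upTo j)) +_) (+-identityʳ (g j)) ⟩
  sum (map g (upTo j)) + g j        ∎
  where open ≡-Reasoning

range1-suc : ∀ D → range1 (suc D) ≡ range1 D ++ [ suc D ]
range1-suc D = trans (cong (map suc) (sym (upTo-∷ʳ D))) (map-++ suc (upTo D) [ D ])

∈-range1⁺ : ∀ {t D} → 1 ≤ t → t ≤ D → t ∈ range1 D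
∈-range1⁺ {suc t} _ t<D = ∈-map⁺ suc (∈-upTo⁺ t<D)

All-range1 : ∀ {P : ℕ → Set} D → (∀ t → 1 ≤ t → t ≤ D → P t) → All P (range1 D)
All-range1 {P} D p = All.tabulate P-at
  where
  P-at : ∀ {t} → t ∈ range1 D → P t
  P-at t∈ with y , y∈ , refl ← ∈-map⁻ suc t∈ = p (suc y) (s≤s z≤n) (∈-upTo⁻ y∈)

count : (X → Bool) → List X → ℕ
count f []       = 0
count f (x ∷ xs) = if f x then suc (count f xs) else count f xs

count-++ : ∀ (f : X → Bool) xs ys → count f (xs ++ ys) ≡ count f xs + count f ys
count-++ f []       ys = refl
count-++ f (x ∷ xs) ys with f x
... | true  = cong suc (count-++ f xs ys)
... | false = count-++ f xs ys

count-map : ∀ (f : Y → Bool) (g : X → Y) xs → count f (map g xs) ≡ count (f ∘ g) xs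
count-map f g []       = refl
count-map f g (x ∷ xs) with f (g x)
... | true  = cong suc (count-map f g xs)
... | false = count-map f g xs

count-cong : ∀ {f g : X → Bool} → (∀ x → f x ≡ g x) → ∀ xs → count f xs ≡ count g xs
count-cong f≗g []       = refl
count-cong {g = g} f≗g (x ∷ xs) rewrite f≗g x =
  cong₂ (if g x then_else_) (cong suc (count-cong f≗g xs)) (count-cong f≗g xs)

count-replicate : ∀ (f : X → Bool) a x → count f (replicate a x) ≡ (if f x then a else 0)
count-replicate f zero    x with f x
... | true  = refl
... | false = refl
count-replicate f (suc a) x with f x | count-replicate f a x
... | true  | ih = cong suc ih
... | false | ih = ih

count-concatMap : ∀ (f : Y → Bool) (g : X → List Y) xs → count f (concatMap g xs) ≡ sum (map (count f ∘ g) xs)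
count-concatMap f g []       = refl
count-concatMap f g (x ∷ xs) =
  trans (count-++ f (g x) (concatMap g xs)) (cong (count f (g x) +_) (count-concatMap f g xs))

count-concatMap-replicate : ∀ (f : Y → Bool) a (g : X → Y) xs →
                            count f (concatMap (λ x → replicate a (g x)) xs) ≡ a * count (f ∘ g) xs
count-concatMap-replicate f a g []       = sym (*-zeroʳ a)
count-concatMap-replicate f a g (x ∷ xs) = begin
  count f (replicate a (g x) ++ rest)                ≡⟨ count-++ f (replicate a (g x)) rest ⟩
  count f (replicate a (g x)) + count f rest         ≡⟨ cong₂ _+_ (count-replicate f a (g x)) (count-concatMap-replicate f a g xs) ⟩
  (if f (g x) then a else 0) + a * count (f ∘ g) xs  ≡⟨ head-term (f (g x)) ⟩
  a * count (f ∘ g) (x ∷ xs)                         ∎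
  where
  open ≡-Reasoning
  rest = concatMap (λ x → replicate a (g x)) xs
  c = count (f ∘ g) xs
  head-term : ∀ β → (if β then a else 0) + a * c ≡ a * (if β then suc c else c)
  head-term true  = sym (*-suc a c)
  head-term false = refl

count-≤-range1 : ∀ D L → count (λ t → does (t ≤? L)) (range1 D) ≡ D ⊓ L
count-≤-range1 zero    L = refl
count-≤-range1 (suc D) L = begin
  count ≤L (range1 (suc D))                ≡⟨ cong (count ≤L) (range1-suc D) ⟩
  count ≤L (range1 D ++ [ suc D ])         ≡⟨ count-++ ≤L (range1 D) [ suc D ] ⟩
  count ≤L (range1 D) + count ≤L [ suc D ] ≡⟨ cong (_+ count ≤L [ suc D ]) (count-≤-range1 D L) ⟩
  D ⊓ L + count ≤L [ suc D ]               ≡⟨ last-term (suc D ≤? L) ⟩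
  suc D ⊓ L                                ∎
  where
  open ≡-Reasoning
  ≤L : ℕ → Bool
  ≤L t = does (t ≤? L)
  last-term : (D<L? : Dec (suc D ≤ L)) → D ⊓ L + (if does D<L? then 1 else 0) ≡ suc D ⊓ L
  last-term (yes D<L) = begin
    D ⊓ L + 1  ≡⟨ cong (_+ 1) (m≤n⇒m⊓n≡m (<⇒≤ D<L)) ⟩
    D + 1      ≡⟨ +-comm D 1 ⟩
    suc D      ≡⟨ m≤n⇒m⊓n≡m D<L ⟨
    suc D ⊓ L  ∎
  last-term (no D≮L) = begin
    D ⊓ L + 0  ≡⟨ +-identityʳ (D ⊓ L) ⟩
    D ⊓ L      ≡⟨ m≥n⇒m⊓n≡n L≤D ⟩
    L          ≡⟨ m≥n⇒m⊓n≡n (m≤n⇒m≤1+n L≤D) ⟨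
    suc D ⊓ L  ∎
    where L≤D = ≤-pred (≰⇒> D≮L)

countTrue-mono : ∀ N {u w : Fin N → Bool} → (∀ l → u l ≡ true → w l ≡ true) → countTrue N u ≤ countTrue N w
countTrue-mono zero    u⇒w = z≤n
countTrue-mono (suc N) {u} {w} u⇒w with u Fin.zero in u₀ | w Fin.zero in w₀
... | true  | true  = s≤s (countTrue-mono N (u⇒w ∘ Fin.suc))
... | false | true  = m≤n⇒m≤1+n (countTrue-mono N (u⇒w ∘ Fin.suc))
... | false | false = countTrue-mono N (u⇒w ∘ Fin.suc)
... | true  | false with () ← trans (sym w₀) (u⇒w Fin.zero u₀)

countTrue-cong : ∀ N {u w : Fin N → Bool} → (∀ l → u l ≡ w l) → countTrue N u ≡ countTrue N w
countTrue-cong N u≗w = ≤-antisym (countTrue-mono N (λ l → trans (sym (u≗w l))))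
                                 (countTrue-mono N (λ l → trans (u≗w l)))

countTrue≤ : ∀ N (u : Fin N → Bool) → countTrue N u ≤ N
countTrue≤ zero    u = z≤n
countTrue≤ (suc N) u with u Fin.zero
... | true  = s≤s (countTrue≤ N (u ∘ Fin.suc))
... | false = m≤n⇒m≤1+n (countTrue≤ N (u ∘ Fin.suc))

countTrue-lookup : ∀ (f : X → Bool) xs → countTrue (length xs) (f ∘ lookup xs) ≡ count f xs
countTrue-lookup f []       = refl
countTrue-lookup f (x ∷ xs) with f x
... | true  = cong suc (countTrue-lookup f xs)
... | false = countTrue-lookup f xs

mapLit : (V → W) → Lit V → Lit W
mapLit f (x , s) = f x , s

module _ {ρ : V → Bool} {F : CNF V} {A : List (Lit V)} (ρ⊨F : Sat ρ F) (ρ⊨A : All (LitTrue ρ) A) where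

  ¬LitTrue-neg : ∀ l → LitTrue ρ l → ¬ LitTrue ρ (neg l)
  ¬LitTrue-neg (x , s) = Bool.not-¬

  mutual
    UP-sound : ∀ {l} → UP F A l → LitTrue ρ l
    UP-sound (given l∈A)          = All.lookup ρ⊨A l∈A
    UP-sound (unit C∈F _ reasons) = unit-sound (All.lookup ρ⊨F C∈F) reasons

    unit-sound : ∀ {C l} → Any (LitTrue ρ) C → All (λ l′ → l′ ≡ l ⊎ UP F A (neg l′)) C → LitTrue ρ l
    unit-sound           (here ρ⊨l′) (inj₁ refl ∷ _)  = ρ⊨l′
    unit-sound {l′ ∷ _}  (here ρ⊨l′) (inj₂ ⊢¬l′ ∷ _)  = ⊥-elim (¬LitTrue-neg l′ ρ⊨l′ (UP-sound ⊢¬l′))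
    unit-sound           (there ρ⊨C) (_ ∷ reasons)    = unit-sound ρ⊨C reasons

  UP-consistent : ¬ Conflict F A
  UP-consistent (inj₁ (x , ⊢x , ⊢¬x)) with () ← trans (sym (UP-sound ⊢x)) (UP-sound ⊢¬x)
  UP-consistent (inj₂ (C , C∈F , ⊢¬C)) = falsified (All.lookup ρ⊨F C∈F) ⊢¬C
    where
    falsified : ∀ {C} → Any (LitTrue ρ) C → ¬ All (λ l → UP F A (neg l)) C
    falsified {l ∷ _} (here ρ⊨l)  (⊢¬l ∷ _) = ¬LitTrue-neg l ρ⊨l (UP-sound ⊢¬l)
    falsified         (there ρ⊨C) (_ ∷ ⊢¬C) = falsified ρ⊨C ⊢¬C

module _ (f : V → W) {F : CNF V} {A : List (Lit V)} {F′ : CNF W} {A′ : List (Lit W)}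
         (F↦F′ : ∀ {C} → C ∈ F → map (mapLit f) C ∈ F′)
         (A↦⊢ : ∀ {l} → l ∈ A → UP F′ A′ (mapLit f l)) where

  mutual
    UP-map : ∀ {l} → UP F A l → UP F′ A′ (mapLit f l)
    UP-map (given l∈A)            = A↦⊢ l∈A
    UP-map (unit C∈F l∈C reasons) = unit (F↦F′ C∈F) (∈-map⁺ (mapLit f) l∈C) (reasons-map reasons)

    reasons-map : ∀ {C l} → All (λ l′ → l′ ≡ l ⊎ UP F A (neg l′)) C →
                  All (λ l′ → l′ ≡ mapLit f l ⊎ UP F′ A′ (neg l′)) (map (mapLit f) C)
    reasons-map []                    = []
    reasons-map (inj₁ refl ∷ reasons) = inj₁ refl ∷ reasons-map reasons
    reasons-map (inj₂ ⊢¬l′ ∷ reasons) = inj₂ (UP-map ⊢¬l′) ∷ reasons-map reasons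

-- Unit propagation on a finite formula is decided by saturation: literals of F move from
-- the candidate list Cand to the derived list D one at a time until none can be propagated.
module _ (_≟_ : DecidableEquality V) (F : CNF V) (A : List (Lit V)) where

  private
    _≟ₗ_ : DecidableEquality (Lit V)
    _≟ₗ_ = ≡-dec _≟_ Bool._≟_

  open DecMembership _≟ₗ_ using (_∈?_)

  Propagates : List (Lit V) → Clause V → Lit V → Set
  Propagates D C l = All (λ l′ → l′ ≡ l ⊎ neg l′ ∈ D) C

  Propagable : List (Lit V) → Lit V → Set
  Propagable D l = Any (λ C → l ∈ C × Propagates D C l) F

  propagable? : ∀ D → Decidable (Propagable D)
  propagable? D l = any? (λ C → (l ∈? C) ×-dec all? (λ l′ → (l′ ≟ₗ l) ⊎-dec (neg l′ ∈? D)) C) F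

  record Saturating (D Cand : List (Lit V)) : Set where
    field
      derived : All (UP F A) D
      given⊆  : ∀ {l} → l ∈ A → l ∈ D
      covers  : ∀ {C l} → C ∈ F → l ∈ C → l ∈ D ⊎ l ∈ Cand

  module _ {D Cand} (inv : Saturating D Cand) where
    open Saturating inv

    propagation-step : ∀ {l} (l∈Cand : l ∈ Cand) → Propagable D l → Saturating (l ∷ D) (Cand ─ l∈Cand)
    propagation-step {l} l∈Cand propagable with C , C∈F , l∈C , prop ← find propagable = record
      { derived = unit C∈F l∈C (All.map (map₂ (All.lookup derived)) prop) ∷ derived
      ; given⊆  = there ∘ given⊆
      ; covers  = covers′
      }
      where
      covers′ : ∀ {C l′} → C ∈ F → l′ ∈ C → l′ ∈ l ∷ D ⊎ l′ ∈ (Cand ─ l∈Cand)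
      covers′ C∈F l′∈C with covers C∈F l′∈C
      ... | inj₁ l′∈D = inj₁ (there l′∈D)
      ... | inj₂ l′∈Cand with ∈-─ Cand l∈Cand l′∈Cand
      ...   | inj₁ refl    = inj₁ (here refl)
      ...   | inj₂ l′∈rest = inj₂ l′∈rest

    module _ (stuck : ¬ Any (Propagable D) Cand) where
      mutual
        saturated : ∀ {l} → UP F A l → l ∈ D
        saturated (given l∈A) = given⊆ l∈A
        saturated (unit C∈F l∈C reasons) with covers C∈F l∈C
        ... | inj₁ l∈D    = l∈D
        ... | inj₂ l∈Cand = ⊥-elim (stuck (lose l∈Cand (lose C∈F (l∈C , saturated-reasons reasons))))

        saturated-reasons : ∀ {C l} → All (λ l′ → l′ ≡ l ⊎ UP F A (neg l′)) C → Propagates D C l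
        saturated-reasons []                    = []
        saturated-reasons (inj₁ l′≡l ∷ reasons) = inj₁ l′≡l ∷ saturated-reasons reasons
        saturated-reasons (inj₂ ⊢¬l′ ∷ reasons) = inj₂ (saturated ⊢¬l′) ∷ saturated-reasons reasons

  UP-closure : Set
  UP-closure = Σ[ D ∈ List (Lit V) ] All (UP F A) D × (∀ {l} → UP F A l → l ∈ D)

  saturate : ∀ fuel D Cand → length Cand ≤ fuel → Saturating D Cand → UP-closure
  saturate fuel D Cand _ inv with any? (propagable? D) Cand
  ... | no stuck = D , Saturating.derived inv , saturated inv stuck
  saturate zero       D []   _       inv | yes ()
  saturate (suc fuel) D Cand |Cand|≤ inv | yes found with l , l∈Cand , prop ← find found =
    saturate fuel (l ∷ D) (Cand ─ l∈Cand) |rest|≤ (propagation-step inv l∈Cand prop)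
    where
    |rest|≤ : length (Cand ─ l∈Cand) ≤ fuel
    |rest|≤ = ≤-pred (≤-trans (≤-reflexive (sym (length-removeAt′ Cand (Any.index l∈Cand)))) |Cand|≤)

  saturating-initial : Saturating A (concat F)
  saturating-initial = record
    { derived = All.tabulate given
    ; given⊆  = id
    ; covers  = λ C∈F l∈C → inj₂ (∈-concat⁺′ l∈C C∈F)
    }

  UP? : Decidable (UP F A)
  UP? l with D , ⊢D , closed ← saturate _ A (concat F) ≤-refl saturating-initial with l ∈? D
  ... | yes l∈D = yes (All.lookup ⊢D l∈D)
  ... | no  l∉D = no (l∉D ∘ closed)

_≟ᵀ_ : ∀ {N} → DecidableEquality (TVar N)
inp a ≟ᵀ inp c = map′ (cong inp) (λ { refl → refl }) (a Fin.≟ c)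
out a ≟ᵀ out c = map′ (cong out) (λ { refl → refl }) (a Fin.≟ c)
aux a ≟ᵀ aux c = map′ (cong aux) (λ { refl → refl }) (a ≟ c)
inp _ ≟ᵀ out _ = no λ ()
inp _ ≟ᵀ aux _ = no λ ()
out _ ≟ᵀ inp _ = no λ ()
out _ ≟ᵀ aux _ = no λ ()
aux _ ≟ᵀ inp _ = no λ ()
aux _ ≟ᵀ out _ = no λ ()

trueInputs : ∀ N → (Fin N → Bool) → List (Lit (TVar N))
trueInputs N u = map (λ l → inp l , true) (filter (λ l → u l Bool.≟ true) (allFin N))

module _ {N} (u : Fin N → Bool) where

  trueInputs⁺ : ∀ {l} → u l ≡ true → (inp l , true) ∈ trueInputs N u
  trueInputs⁺ {l} ul = ∈-map⁺ _ (∈-filter⁺ (λ l → u l Bool.≟ true) (∈-allFin l) ul)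

  All-trueInputs : ∀ {P : Lit (TVar N) → Set} → (∀ {l} → u l ≡ true → P (inp l , true)) → All P (trueInputs N u)
  All-trueInputs p = map⁺ (All.map p (all-filter (λ l → u l Bool.≟ true) (allFin N)))

module _ (E : SNEncoding) where
  open SNEncoding E

  -- Domain consistency only refutes ¬ UP; decidability of UP turns the refutation into a derivation.
  net-threshold : ∀ N (u : Fin N → Bool) (k : Fin N) → suc (toℕ k) ≤ countTrue N u →
                  UP (net N) (trueInputs N u) (out k , true)
  net-threshold N u k k<#u with UP? _≟ᵀ_ (net N) (trueInputs N u) (out k , true)
  ... | yes ⊢out = ⊢out
  ... | no  ⊬out
    with ρ , ρ⊨net , ρ-inp ← complete N u
    with τ , τ∈R , τ-agrees , τ-out ← proj₁ (dc N (trueInputs N u) (All-trueInputs u (λ _ → inpP)))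
           (UP-consistent ρ⊨net (All-trueInputs u (λ {l} ul → trans (ρ-inp l) ul))) (out k) outP false ⊬out
    with () ← trans (sym τ-out) (proj₂ (τ∈R k) (≤-trans k<#u (countTrue-mono N
                (λ l ul → τ-agrees (inp l) inpP true (given (trueInputs⁺ u ul))))))

Sat-instCNF : ∀ {N} {ρ : Var → Bool} {τ : TVar N → Bool} (f : TVar N → Var) {F : CNF (TVar N)} →
              (∀ t → ρ (f t) ≡ τ t) → Sat τ F → Sat ρ (instCNF f F)
Sat-instCNF f ρ∘f≗τ τ⊨F =
  map⁺ (All.map (λ τ⊨C → Any.map⁺ (Any.map (λ {l} τ⊨l → trans (ρ∘f≗τ (proj₁ l)) τ⊨l) τ⊨C)) τ⊨F)

module Cascade (E : SNEncoding) (b-1 m n : ℕ) (d A v : ℕ → ℕ → ℕ)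
             (v≤d : ∀ i j → 1 ≤ i → i ≤ n → j ≤ m → v i j ≤ d i j) where
  open SNEncoding E

  b : ℕ
  b = suc b-1

  columnSum : ℕ → ℕ
  columnSum j = sum (map (λ i → A i j * v i j) (range1 n))

  level : ℕ → ℕ
  level j = _/_ (weightedSum b j n A v) (b ^ j) {{m^n≢0 b j}}

  level-zero : level 0 ≡ columnSum 0
  level-zero = trans (n/1≡n _) (trans (+-identityʳ _) (*-identityˡ _))

  level-suc : ∀ j → level (suc j) ≡ level j / b + columnSum (suc j)
  level-suc j = begin
    level (suc j)                                   ≡⟨ /-congˡ (sum-map-upTo-suc (λ k → b ^ k * columnSum k) (suc j)) ⟩
    (wⱼ + b ^ suc j * columnSum (suc j)) / b ^ suc j ≡⟨ [m+n*o]/n≡m/n+o wⱼ (b ^ suc j) (columnSum (suc j)) ⟩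
    wⱼ / b ^ suc j + columnSum (suc j)              ≡⟨ cong (_+ columnSum (suc j)) (m/n^[1+k]≡m/n^k/n wⱼ b j) ⟩
    level j / b + columnSum (suc j)                 ∎
    where
    open ≡-Reasoning
    wⱼ = weightedSum b j n A v
    instance _ = m^n≢0 b (suc j)

  inputsOf : ℕ → List Var
  inputsOf = inputs b n d A

  size : ℕ → ℕ
  size j = length (inputsOf j)

  All-Xcol : ∀ {P : Var → Set} j → (∀ i k → 1 ≤ i → i ≤ n → 1 ≤ k → P (xv i j k)) → All P (Xcol n d A j)
  All-Xcol j p = All-concatMap (All-range1 n λ i 1≤i i≤n →
                   All-concatMap (All-range1 (d i j) λ k 1≤k _ → replicate⁺ (A i j) (p i k 1≤i i≤n 1≤k)))

  All-carries : ∀ {P : Var → Set} j N → (∀ t → 1 ≤ t → P (yv j (b * t))) → All P (carries b j N)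
  All-carries j N p = map⁺ (All-range1 (N / b) λ t 1≤t _ → p t 1≤t)

  -- y_j^0 does not occur in G, so its value (true) is irrelevant.
  value : Var → Bool
  value (xv i j k) = does (k ≤? v i j)
  value (yv j s)   = does (s ≤? level j)
  value (av _ _)   = false

  inputBits : ∀ j → Fin (size j) → Bool
  inputBits j = value ∘ lookup (inputsOf j)

  netModel : ∀ j → TVar (size j) → Bool
  netModel j = proj₁ (complete (size j) (inputBits j))

  σ : Var → Bool
  σ (av j a) = netModel j (aux a)
  σ z        = value z

  σ≡value-on-inputs : ∀ j → All (λ z → σ z ≡ value z) (inputsOf j)
  σ≡value-on-inputs zero    = All-Xcol zero (λ _ _ _ _ _ → refl)
  σ≡value-on-inputs (suc j) = ++⁺ (All-carries j (size j) (λ _ _ → refl)) (All-Xcol (suc j) (λ _ _ _ _ _ → refl))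

  count-Xcol : ∀ j → j ≤ m → count value (Xcol n d A j) ≡ columnSum j
  count-Xcol j j≤m = begin
    count value (Xcol n d A j)                              ≡⟨ count-concatMap value (λ i → Xlist d A i j) (range1 n) ⟩
    sum (map (λ i → count value (Xlist d A i j)) (range1 n)) ≡⟨ cong sum (map-cong-local (All-range1 n count-Xlist)) ⟩
    columnSum j                                             ∎
    where
    open ≡-Reasoning
    count-Xlist : ∀ i → 1 ≤ i → i ≤ n → count value (Xlist d A i j) ≡ A i j * v i j
    count-Xlist i 1≤i i≤n = begin
      count value (Xlist d A i j)                                ≡⟨ count-concatMap-replicate value (A i j) (xv i j) (range1 (d i j)) ⟩
      A i j * count (λ k → does (k ≤? v i j)) (range1 (d i j))  ≡⟨ cong (A i j *_) (count-≤-range1 (d i j) (v i j)) ⟩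
      A i j * (d i j ⊓ v i j)                                   ≡⟨ cong (A i j *_) (m≥n⇒m⊓n≡n (v≤d i j 1≤i i≤n j≤m)) ⟩
      A i j * v i j                                             ∎

  count-carries : ∀ j → level j ≤ size j → count value (carries b j (size j)) ≡ level j / b
  count-carries j level≤size = begin
    count value (carries b j (size j))                          ≡⟨ count-map value (λ t → yv j (b * t)) (range1 (size j / b)) ⟩
    count (λ t → does (b * t ≤? level j)) (range1 (size j / b)) ≡⟨ count-cong carry-threshold (range1 (size j / b)) ⟩
    count (λ t → does (t ≤? level j / b)) (range1 (size j / b)) ≡⟨ count-≤-range1 (size j / b) (level j / b) ⟩
    (size j / b) ⊓ (level j / b)                                ≡⟨ m≥n⇒m⊓n≡n (/-monoˡ-≤ b level≤size) ⟩
    level j / b                                                 ∎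
    where
    open ≡-Reasoning
    carry-threshold : ∀ t → does (b * t ≤? level j) ≡ does (t ≤? level j / b)
    carry-threshold t = trans (cong (λ x → does (x ≤? level j)) (*-comm b t))
                              (sym (does-⇔ (m≤n/o⇔m*o≤n t (level j) b) (t ≤? level j / b) (t * b ≤? level j)))

  mutual
    inputCount≡level : ∀ j → j ≤ m → countTrue (size j) (inputBits j) ≡ level j
    inputCount≡level j j≤m = trans (countTrue-lookup value (inputsOf j)) (count-inputs j j≤m)

    count-inputs : ∀ j → j ≤ m → count value (inputsOf j) ≡ level j
    count-inputs zero    j≤m = trans (count-Xcol zero j≤m) (sym level-zero)
    count-inputs (suc j) j≤m = begin
      count value (carries b j (size j) ++ Xcol n d A (suc j))           ≡⟨ count-++ value (carries b j (size j)) _ ⟩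
      count value (carries b j (size j)) + count value (Xcol n d A (suc j))
        ≡⟨ cong₂ _+_ (count-carries j (level≤size j (<⇒≤ j≤m))) (count-Xcol (suc j) j≤m) ⟩
      level j / b + columnSum (suc j)                                     ≡⟨ level-suc j ⟨
      level (suc j)                                                       ∎
      where open ≡-Reasoning

    level≤size : ∀ j → j ≤ m → level j ≤ size j
    level≤size j j≤m = subst (_≤ size j) (inputCount≡level j j≤m) (countTrue≤ (size j) (inputBits j))

  netModel⊨net : ∀ j → Sat (netModel j) (net (size j))
  netModel⊨net j = proj₁ (proj₂ (complete (size j) (inputBits j)))

  netModel-inp : ∀ j l → netModel j (inp l) ≡ inputBits j l
  netModel-inp j = proj₂ (proj₂ (complete (size j) (inputBits j)))

  netModel-out : ∀ j → j ≤ m → ∀ k → netModel j (out k) ≡ does (suc (toℕ k) ≤? level j)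
  netModel-out j j≤m k = ≡-does (suc (toℕ k) ≤? level j)
    (λ out-true → subst (suc (toℕ k) ≤_) #inputs≡level (proj₁ (netModel∈R k) out-true))
    (λ k<level → proj₂ (netModel∈R k) (subst (suc (toℕ k) ≤_) (sym #inputs≡level) k<level))
    where
    netModel∈R = sound (size j) (netModel j) (netModel⊨net j)
    #inputs≡level : countTrue (size j) (λ l → netModel j (inp l)) ≡ level j
    #inputs≡level = trans (countTrue-cong (size j) (netModel-inp j)) (inputCount≡level j j≤m)

  σ∘instVar≗netModel : ∀ j → j ≤ m → ∀ t → σ (instVar j (inputsOf j) t) ≡ netModel j t
  σ∘instVar≗netModel j j≤m (inp l) = trans (All.lookup (σ≡value-on-inputs j) (∈-lookup l)) (sym (netModel-inp j l))
  σ∘instVar≗netModel j j≤m (out k) = sym (netModel-out j j≤m k)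
  σ∘instVar≗netModel j j≤m (aux a) = refl

  σ⊨order-clause : ∀ i j k → Any (LitTrue σ) ((xv i j (suc k) , false) ∷ (xv i j k , true) ∷ [])
  σ⊨order-clause i j k with suc k ≤? v i j
  ... | yes k<v = there (here (dec-true (k ≤? v i j) (<⇒≤ k<v)))
  ... | no  k≮v = here (dec-false (suc k ≤? v i j) k≮v)

  σ⊨G : Sat σ (G E b m n d A)
  σ⊨G = ++⁺ (All-concatMap (All.universal (λ i → All-concatMap (All.universal (λ j →
                map⁺ (All.universal (σ⊨order-clause i j) (range1 (d i j ∸ 1)))) (range0 m))) (range1 n)))
            (All-concatMap (All.tabulate λ {j} j∈ →
              Sat-instCNF (instVar j (inputsOf j)) (σ∘instVar≗netModel j (≤-pred (∈-upTo⁻ j∈))) (netModel⊨net j)))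

  σ⊨assignment : All (LitTrue σ) (assignment m n v)
  σ⊨assignment = All-concatMap (All.universal (λ i → All-concatMap (All.universal (λ j →
                   map⁺ (All-range1 (v i j) λ k _ k≤v → dec-true (k ≤? v i j) k≤v)) (range0 m))) (range1 n))

  network⊆G : ∀ j → j ≤ m → ∀ {C} → C ∈ net (size j) → map (mapLit (instVar j (inputsOf j))) C ∈ G E b m n d A
  network⊆G j j≤m C∈ = ∈-++⁺ʳ (orderClauses m n d) (∈-concatMap⁺ _ (lose (∈-upTo⁺ (s≤s j≤m)) (∈-map⁺ _ C∈)))

  ∈-assignment : ∀ {i j k} → 1 ≤ i → i ≤ n → j ≤ m → 1 ≤ k → k ≤ v i j → (xv i j k , true) ∈ assignment m n v
  ∈-assignment 1≤i i≤n j≤m 1≤k k≤v =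
    ∈-concatMap⁺ _ (lose (∈-range1⁺ 1≤i i≤n)
      (∈-concatMap⁺ _ (lose (∈-upTo⁺ (s≤s j≤m)) (∈-map⁺ _ (∈-range1⁺ 1≤k k≤v)))))

  Propagated : Lit Var → Set
  Propagated = UP (G E b m n d A) (assignment m n v)

  ⊢_ : Var → Set
  ⊢ z = Propagated (z , true)

  derive-x : ∀ {j} → j ≤ m → ∀ i k → 1 ≤ i → i ≤ n → 1 ≤ k → value (xv i j k) ≡ true → ⊢ xv i j k
  derive-x {j} j≤m i k 1≤i i≤n 1≤k k≤v = given (∈-assignment 1≤i i≤n j≤m 1≤k (dec-true⁻¹ (k ≤? v i j) k≤v))

  mutual
    derive-level : ∀ j → j ≤ m → ∀ s → 1 ≤ s → s ≤ level j → ⊢ yv j s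
    derive-level j j≤m (suc k) _ s≤level =
      subst (λ x → ⊢ yv j (suc x)) (Fin.toℕ-fromℕ< k<size)
        (UP-map (instVar j (inputsOf j)) (network⊆G j j≤m) (All.lookup (derive-trueInputs j j≤m))
          (net-threshold E (size j) (inputBits j) (fromℕ< k<size)
            (subst₂ (λ x y → suc x ≤ y) (sym (Fin.toℕ-fromℕ< k<size)) (sym (inputCount≡level j j≤m)) s≤level)))
      where
      k<size : k < size j
      k<size = ≤-trans s≤level (level≤size j j≤m)

    derive-trueInputs : ∀ j → j ≤ m → All (Propagated ∘ mapLit (instVar j (inputsOf j))) (trueInputs (size j) (inputBits j))
    derive-trueInputs j j≤m = All-trueInputs (inputBits j) (λ {l} → All.lookup (derive-inputs j j≤m) (∈-lookup l))

    derive-inputs : ∀ j → j ≤ m → All (λ z → value z ≡ true → ⊢ z) (inputsOf j)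
    derive-inputs zero    j≤m = All-Xcol zero (derive-x j≤m)
    derive-inputs (suc j) j≤m = ++⁺ (All-carries j (size j) derive-carry) (All-Xcol (suc j) (derive-x j≤m))
      where
      derive-carry : ∀ t → 1 ≤ t → value (yv j (b * t)) ≡ true → ⊢ yv j (b * t)
      derive-carry (suc t) _ bt≤level =
        derive-level j (<⇒≤ j≤m) (b * suc t) (s≤s z≤n) (dec-true⁻¹ (b * suc t ≤? level j) bt≤level)

lemma2 : (E : SNEncoding) (b m n : ℕ) (d A v : ℕ → ℕ → ℕ) →
    1 < b →
    (∀ i j → 1 ≤ i → i ≤ n → j ≤ m → A i j < b) →
    (∀ i j → 1 ≤ i → i ≤ n → j ≤ m → v i j ≤ d i j) →
    ((b ^ suc m ∸ 1 < weightedSum b m n A v)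
      ⇔ UP (G E b m n d A) (assignment m n v) (yv m b , true))
lemma2 E zero      m n d A v () _ _
lemma2 E (suc b-1) m n d A v _  _ v≤d = mk⇔
  (λ W≥b^[1+m] → derive-level m ≤-refl b (s≤s z≤n) (Equivalence.to threshold W≥b^[1+m]))
  (λ ⊢y → Equivalence.from threshold (dec-true⁻¹ (b ≤? level m) (UP-sound σ⊨G σ⊨assignment ⊢y)))
  where
  open Cascade E b-1 m n d A v v≤d
  threshold : b ^ suc m ∸ 1 < weightedSum b m n A v ⇔ b ≤ level m
  threshold = ⇔.trans (m∸1<n⇔m≤n (b ^ suc m) _ {{m^n≢0 b (suc m)}})
                      (⇔.sym (m≤n/o⇔m*o≤n b _ (b ^ m) {{m^n≢0 b m}}))
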